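{- $C(n,C_4)=\Omega(n^{1/3})$ as $n\to\infty$, where $C_4$ is the cycle on $4$ vertices.
   Context: For a graph $H$ and a positive integer $n$, $C(n,H)$ denotes the minimum integer $k$ such that there exist $n$ colorings $f_v:E(K_n)\to[k]$, one for each vertex $v\in V(K_n)$ (the colorings need not be proper), with the following property: for every copy $T$ of $H$ in $K_n$, there is a vertex $v\in V(T)$ such that $f_v$ assigns pairwise distinct colors to all edges of $E(T)$. -}

module Defs where

open import Data.Nat using (ℕ)
open import Data.Fin using (Fin)
open import Data.Product using (Σ; _×_)
open import Data.Sum using (_⊎_)
open import Relation.Binary.PropositionalEquality using (_≡_; _≢_)

-- A colouring of E(K_n) with colours [k] = Fin k, represented as a
-- symmetric function on pairs of vertices (values on the diagonal u = u
-- are irrelevant: loops are not edges of K_n).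
EdgeColouring : ℕ → ℕ → Set
EdgeColouring n k = Fin n → Fin n → Fin k

Symmetric : ∀ {n k} → EdgeColouring n k → Set
Symmetric {n} f = (u w : Fin n) → f u w ≡ f w u

Distinct4 : ∀ {n} → Fin n → Fin n → Fin n → Fin n → Set
Distinct4 a b c d =
  a ≢ b × a ≢ c × a ≢ d × b ≢ c × b ≢ d × c ≢ d

RainbowC4 : ∀ {n k} → EdgeColouring n k → Fin n → Fin n → Fin n → Fin n → Set
RainbowC4 f a b c d =
  f a b ≢ f b c × f a b ≢ f c d × f a b ≢ f d a ×
  f b c ≢ f c d × f b c ≢ f d a × f c d ≢ f d a

ColouringFamily : ℕ → ℕ → Set
ColouringFamily n k = Fin n → EdgeColouring n k

GoodForC4 : ∀ {n k} → ColouringFamily n k → Set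
GoodForC4 {n} F = (a b c d : Fin n) → Distinct4 a b c d →
  RainbowC4 (F a) a b c d ⊎ RainbowC4 (F b) a b c d ⊎
  RainbowC4 (F c) a b c d ⊎ RainbowC4 (F d) a b c d

-- k colours suffice for (n, C_4), i.e. C(n, C_4) ≤ k.
AdmitsC4 : ℕ → ℕ → Set
AdmitsC4 n k = Σ (ColouringFamily n k) λ F →
  ((v : Fin n) → Symmetric (F v)) × GoodForC4 F

-- Let u see a vertex x in the colour f_u(ux). Cauchy–Schwarz over the k colour
-- classes gives every u at least n²/k ordered pairs (a, c) seen in a common colour,
-- hence at least n³/k such triples (u, a, c). Conversely fix a ≠ c. Two centres
-- b, d ∉ {a, c} with (f_a(ab), f_c(cb)) = (f_a(ad), f_c(cd)) are impossible: every
-- vertex of the 4-cycle a-b-c-d would see its two cycle-neighbours in one colour,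
-- so none of f_a, f_b, f_c, f_d is rainbow on it. So a ≠ c have at most k² + 2
-- common centres, there are at most n²(k² + 3) triples, and n ≤ k(k² + 3) ≤ 4k³.
module Submission where

open import Defs
open import Data.Nat using (ℕ; zero; suc; _+_; _*_; _^_; _≤_; _<_; _<?_; z≤n; s≤s)
open import Data.Nat.Properties hiding (_≟_; suc-injective)
open import Data.Nat.Tactic.RingSolver using (solve-∀)
open import Algebra.Properties.Semiring.Sum +-*-semiring
  using (sum; sum-syntax; ∑-comm; ∑-distrib-+; *-distribˡ-sum; *-distribʳ-sum; sum-cong-≗)
open import Data.Fin using (Fin; zero; suc; combine)
open import Data.Fin.Properties using (_≟_; suc-injective; combine-injective)
open import Data.Product using (Σ; _×_; _,_; ∃; ∃₂)
open import Data.Sum using (_⊎_; inj₁; inj₂; [_,_])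
open import Function using (_∘_; id)
open import Level using (0ℓ)
open import Relation.Nullary using (Dec; yes; no; ¬_; contradiction)
open import Relation.Nullary.Decidable using (¬?; _×-dec_; _⊎-dec_)
open import Relation.Unary using (Pred; Decidable)
open import Relation.Binary.PropositionalEquality hiding ([_])

sum-const : ∀ n c → ∑[ i < n ] c ≡ n * c
sum-const zero c = refl
sum-const (suc n) c = cong (c +_) (sum-const n c)

sum-mono-≤ : ∀ {n} {f g : Fin n → ℕ} → (∀ i → f i ≤ g i) → sum f ≤ sum g
sum-mono-≤ {zero} f≤g = z≤n
sum-mono-≤ {suc n} f≤g = +-mono-≤ (f≤g zero) (sum-mono-≤ (f≤g ∘ suc))

pigeonhole-sum : ∀ {n} (f : Fin n → ℕ) c → n * c < sum f → ∃ λ i → c < f i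
pigeonhole-sum {zero} f c ()
pigeonhole-sum {suc n} f c nc<∑f with c <? f zero
... | yes c<f₀ = zero , c<f₀
... | no c≮f₀ with pigeonhole-sum (f ∘ suc) c (+-cancelˡ-< c _ _ (<-≤-trans nc<∑f (+-monoˡ-≤ _ (≮⇒≥ c≮f₀))))
...   | i , c<fᵢ = suc i , c<fᵢ

2*ab≤a²+b²-ordered : ∀ {a b} → a ≤ b → 2 * (a * b) ≤ a * a + b * b
2*ab≤a²+b²-ordered {a} a≤b with d , refl ← m≤n⇒∃[o]m+o≡n a≤b =
  subst (2 * (a * (a + d)) ≤_) (expand a d) (m≤m+n _ (d * d))
  where
  expand : ∀ a d → 2 * (a * (a + d)) + d * d ≡ a * a + (a + d) * (a + d)
  expand = solve-∀

2*ab≤a²+b² : ∀ a b → 2 * (a * b) ≤ a * a + b * b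
2*ab≤a²+b² a b with ≤-total a b
... | inj₁ a≤b = 2*ab≤a²+b²-ordered a≤b
... | inj₂ b≤a = subst₂ _≤_ (cong (2 *_) (*-comm b a)) (+-comm (b * b) (a * a)) (2*ab≤a²+b²-ordered b≤a)

cauchy-schwarz : ∀ {k} (m : Fin k → ℕ) → sum m * sum m ≤ k * ∑[ i < k ] (m i * m i)
cauchy-schwarz {k} m = *-cancelˡ-≤ 2 (begin
  2 * (sum m * sum m)                           ≡⟨ cong (2 *_) square ⟩
  2 * (∑[ i < k ] ∑[ j < k ] (m i * m j))        ≡⟨ double ⟩
  ∑[ i < k ] ∑[ j < k ] (2 * (m i * m j))         ≤⟨ sum-mono-≤ (λ i → sum-mono-≤ (λ j → 2*ab≤a²+b² (m i) (m j))) ⟩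
  ∑[ i < k ] ∑[ j < k ] (m i * m i + m j * m j)  ≡⟨ split ⟩
  2 * (k * Q)                                   ∎)
  where
  open ≤-Reasoning
  Q = ∑[ i < k ] (m i * m i)
  square : sum m * sum m ≡ ∑[ i < k ] ∑[ j < k ] (m i * m j)
  square = trans (*-distribʳ-sum (sum m) m) (sum-cong-≗ (λ i → *-distribˡ-sum (m i) m))
  double : 2 * (∑[ i < k ] ∑[ j < k ] (m i * m j)) ≡ ∑[ i < k ] ∑[ j < k ] (2 * (m i * m j))
  double = trans (*-distribˡ-sum 2 (λ i → ∑[ j < k ] (m i * m j)))
                 (sum-cong-≗ (λ i → *-distribˡ-sum 2 (λ j → m i * m j)))
  split : ∑[ i < k ] ∑[ j < k ] (m i * m i + m j * m j) ≡ 2 * (k * Q)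
  split = begin-equality
    ∑[ i < k ] ∑[ j < k ] (m i * m i + m j * m j)  ≡⟨ sum-cong-≗ (λ i → ∑-distrib-+ (λ _ → m i * m i) (λ j → m j * m j)) ⟩
    ∑[ i < k ] (∑[ j < k ] (m i * m i) + Q)        ≡⟨ sum-cong-≗ (λ i → cong (_+ Q) (sum-const k (m i * m i))) ⟩
    ∑[ i < k ] (k * (m i * m i) + Q)               ≡⟨ ∑-distrib-+ (λ i → k * (m i * m i)) (λ _ → Q) ⟩
    ∑[ i < k ] (k * (m i * m i)) + ∑[ i < k ] Q    ≡⟨ cong₂ _+_ (sym (*-distribˡ-sum k (λ i → m i * m i))) (sum-const k Q) ⟩
    k * Q + k * Q                                  ≡⟨ cong (k * Q +_) (sym (+-identityʳ (k * Q))) ⟩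
    2 * (k * Q)                                    ∎

𝟙 : ∀ {p} {P : Set p} → Dec P → ℕ
𝟙 (yes _) = 1
𝟙 (no _)  = 0

𝟙≤1 : ∀ {p} {P : Set p} (P? : Dec P) → 𝟙 P? ≤ 1
𝟙≤1 (yes _) = s≤s z≤n
𝟙≤1 (no _)  = z≤n

𝟙-≡0 : ∀ {p} {P : Set p} (P? : Dec P) → ¬ P → 𝟙 P? ≡ 0
𝟙-≡0 (yes p) ¬p = contradiction p ¬p
𝟙-≡0 (no _)  _  = refl

𝟙-cong : ∀ {p q} {P : Set p} {Q : Set q} (P? : Dec P) (Q? : Dec Q) → (P → Q) → (Q → P) → 𝟙 P? ≡ 𝟙 Q?
𝟙-cong (yes _) (yes _) _   _   = refl
𝟙-cong (yes p) (no ¬q) P→Q _   = contradiction (P→Q p) ¬q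
𝟙-cong (no ¬p) (yes q) _   Q→P = contradiction (Q→P q) ¬p
𝟙-cong (no _)  (no _)  _   _   = refl

𝟙-× : ∀ {p q} {P : Set p} {Q : Set q} (P? : Dec P) (Q? : Dec Q) → 𝟙 (P? ×-dec Q?) ≡ 𝟙 P? * 𝟙 Q?
𝟙-× (yes _) (yes _) = refl
𝟙-× (yes _) (no _)  = refl
𝟙-× (no _)  _       = refl

𝟙-⊎-≤ : ∀ {p q r} {P : Set p} {Q : Set q} {R : Set r} (P? : Dec P) (Q? : Dec Q) (R? : Dec R) →
        (P → Q ⊎ R) → 𝟙 P? ≤ 𝟙 Q? + 𝟙 R?
𝟙-⊎-≤ (no _)  _       _       _     = z≤n
𝟙-⊎-≤ (yes _) (yes _) _       _     = s≤s z≤n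
𝟙-⊎-≤ (yes _) (no _)  (yes _) _     = s≤s z≤n
𝟙-⊎-≤ (yes p) (no ¬q) (no ¬r) P→Q⊎R = contradiction (P→Q⊎R p) [ ¬q , ¬r ]

∑-𝟙≟* : ∀ {n} (i : Fin n) (h : Fin n → ℕ) → ∑[ j < n ] (𝟙 (i ≟ j) * h j) ≡ h i
∑-𝟙≟* {suc n} zero h = begin
  h zero + 0 + ∑[ j < n ] (𝟙 (zero ≟ suc j) * h (suc j))  ≡⟨ cong (h zero + 0 +_) (sum-cong-≗ (λ j → cong (_* h (suc j)) (𝟙-≡0 (zero ≟ suc j) λ ()))) ⟩
  h zero + 0 + ∑[ j < n ] 0                                ≡⟨ cong (h zero + 0 +_) (trans (sum-const n 0) (*-zeroʳ n)) ⟩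
  h zero + 0 + 0                                           ≡⟨ trans (+-identityʳ _) (+-identityʳ _) ⟩
  h zero                                                   ∎
  where open ≡-Reasoning
∑-𝟙≟* {suc n} (suc i) h = begin
  𝟙 (suc i ≟ zero) * h zero + ∑[ j < n ] (𝟙 (suc i ≟ suc j) * h (suc j))
    ≡⟨ cong₂ _+_ (cong (_* h zero) (𝟙-≡0 (suc i ≟ zero) λ ()))
                 (sum-cong-≗ (λ j → cong (_* h (suc j)) (𝟙-cong (suc i ≟ suc j) (i ≟ j) suc-injective (cong suc)))) ⟩
  ∑[ j < n ] (𝟙 (i ≟ j) * h (suc j))
    ≡⟨ ∑-𝟙≟* i (h ∘ suc) ⟩
  h (suc i) ∎
  where open ≡-Reasoning

count : ∀ {n p} {P : Pred (Fin n) p} → Decidable P → ℕ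
count P? = sum (𝟙 ∘ P?)

count-≤ : ∀ {n p} {P : Pred (Fin n) p} (P? : Decidable P) → count P? ≤ n
count-≤ {n} P? = begin
  count P?       ≤⟨ sum-mono-≤ (𝟙≤1 ∘ P?) ⟩
  ∑[ i < n ] 1   ≡⟨ trans (sum-const n 1) (*-identityʳ n) ⟩
  n              ∎
  where open ≤-Reasoning

count-≟ : ∀ {n} (i : Fin n) → count (i ≟_) ≡ 1
count-≟ i = trans (sum-cong-≗ (λ j → sym (*-identityʳ (𝟙 (i ≟ j))))) (∑-𝟙≟* i (λ _ → 1))

count-pos : ∀ {n p} {P : Pred (Fin n) p} (P? : Decidable P) → 0 < count P? → ∃ P
count-pos {suc n} {P = P} P? = split (P? zero)
  where
  split : (P₀? : Dec (P zero)) → 0 < 𝟙 P₀? + count (P? ∘ suc) → ∃ P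
  split (yes p₀) _ = zero , p₀
  split (no _) 0<c with i , pᵢ ← count-pos (P? ∘ suc) 0<c = suc i , pᵢ

count-two : ∀ {n p} {P : Pred (Fin n) p} (P? : Decidable P) → 1 < count P? →
            ∃₂ λ i j → i ≢ j × P i × P j
count-two {suc n} {P = P} P? = split (P? zero)
  where
  split : (P₀? : Dec (P zero)) → 1 < 𝟙 P₀? + count (P? ∘ suc) → ∃₂ λ i j → i ≢ j × P i × P j
  split (yes p₀) 1<c with j , pⱼ ← count-pos (P? ∘ suc) (≤-pred 1<c) = zero , suc j , (λ ()) , p₀ , pⱼ
  split (no _) 1<c with i , j , i≢j , pᵢ , pⱼ ← count-two (P? ∘ suc) 1<c =
    suc i , suc j , i≢j ∘ suc-injective , pᵢ , pⱼ

count-∑-fibres : ∀ {n m p} {P : Pred (Fin n) p} (P? : Decidable P) (φ : Fin n → Fin m) →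
                 count P? ≡ ∑[ c < m ] count (λ u → φ u ≟ c ×-dec P? u)
count-∑-fibres {n} {m} P? φ = begin
  count P?                                          ≡⟨ sum-cong-≗ (λ u → sym (∑-𝟙≟* (φ u) (λ _ → 𝟙 (P? u)))) ⟩
  ∑[ u < n ] ∑[ c < m ] (𝟙 (φ u ≟ c) * 𝟙 (P? u))   ≡⟨ sum-cong-≗ (λ u → sum-cong-≗ (λ c → sym (𝟙-× (φ u ≟ c) (P? u)))) ⟩
  ∑[ u < n ] ∑[ c < m ] 𝟙 (φ u ≟ c ×-dec P? u)      ≡⟨ ∑-comm (λ u c → 𝟙 (φ u ≟ c ×-dec P? u)) ⟩
  ∑[ c < m ] ∑[ u < n ] 𝟙 (φ u ≟ c ×-dec P? u)      ∎
  where open ≡-Reasoning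

count-pigeonhole : ∀ {n m p} {P : Pred (Fin n) p} (P? : Decidable P) (φ : Fin n → Fin m) →
                   m < count P? → ∃₂ λ i j → i ≢ j × P i × P j × φ i ≡ φ j
count-pigeonhole {m = m} P? φ m<count
  with c , 1<fibre ← pigeonhole-sum _ 1 (subst₂ _<_ (sym (*-identityʳ m)) (count-∑-fibres P? φ) m<count)
  with i , j , i≢j , (φi≡c , pᵢ) , (φj≡c , pⱼ) ← count-two (λ u → φ u ≟ c ×-dec P? u) 1<fibre
  = i , j , i≢j , pᵢ , pⱼ , trans φi≡c (sym φj≡c)

collisions : ∀ {r k} → (Fin r → Fin k) → ℕ
collisions {r} φ = ∑[ a < r ] count (λ c → φ c ≟ φ a)

square≤colours*collisions : ∀ {r k} (φ : Fin r → Fin k) → r * r ≤ k * collisions φ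
square≤colours*collisions {r} {k} φ =
  subst₂ (λ s q → s * s ≤ k * q) ∑classSize≡r ∑classSize²≡collisions (cauchy-schwarz classSize)
  where
  open ≡-Reasoning
  classSize : Fin k → ℕ
  classSize x = count (λ a → φ a ≟ x)
  ∑classSize≡r : sum classSize ≡ r
  ∑classSize≡r = begin
    ∑[ x < k ] ∑[ a < r ] 𝟙 (φ a ≟ x)   ≡⟨ ∑-comm (λ x a → 𝟙 (φ a ≟ x)) ⟩
    ∑[ a < r ] count (φ a ≟_)           ≡⟨ sum-cong-≗ (count-≟ ∘ φ) ⟩
    ∑[ a < r ] 1                        ≡⟨ trans (sum-const r 1) (*-identityʳ r) ⟩
    r                                   ∎
  classSize² : ∀ x → classSize x * classSize x ≡ ∑[ a < r ] ∑[ c < r ] (𝟙 (φ a ≟ x) * 𝟙 (φ c ≟ x))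
  classSize² x = trans (*-distribʳ-sum (classSize x) (λ a → 𝟙 (φ a ≟ x)))
                       (sum-cong-≗ (λ a → *-distribˡ-sum (𝟙 (φ a ≟ x)) (λ c → 𝟙 (φ c ≟ x))))
  ∑classSize²≡collisions : ∑[ x < k ] (classSize x * classSize x) ≡ collisions φ
  ∑classSize²≡collisions = begin
    ∑[ x < k ] (classSize x * classSize x)                            ≡⟨ sum-cong-≗ classSize² ⟩
    ∑[ x < k ] ∑[ a < r ] ∑[ c < r ] (𝟙 (φ a ≟ x) * 𝟙 (φ c ≟ x))   ≡⟨ ∑-comm (λ x a → ∑[ c < r ] (𝟙 (φ a ≟ x) * 𝟙 (φ c ≟ x))) ⟩
    ∑[ a < r ] ∑[ x < k ] ∑[ c < r ] (𝟙 (φ a ≟ x) * 𝟙 (φ c ≟ x))   ≡⟨ sum-cong-≗ (λ a → ∑-comm (λ x c → 𝟙 (φ a ≟ x) * 𝟙 (φ c ≟ x))) ⟩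
    ∑[ a < r ] ∑[ c < r ] ∑[ x < k ] (𝟙 (φ a ≟ x) * 𝟙 (φ c ≟ x))   ≡⟨ sum-cong-≗ (λ a → sum-cong-≗ (λ c → ∑-𝟙≟* (φ a) (λ x → 𝟙 (φ c ≟ x)))) ⟩
    collisions φ                                                      ∎

module _ {n k} (F : ColouringFamily n k) where

  seen : Fin n → Fin n → Fin k
  seen u x = F u u x

  ∑collisions≥ : n * (n * n) ≤ k * ∑[ u < n ] collisions (seen u)
  ∑collisions≥ = begin
    n * (n * n)                             ≡⟨ sum-const n (n * n) ⟨
    ∑[ u < n ] (n * n)                      ≤⟨ sum-mono-≤ (λ u → square≤colours*collisions (seen u)) ⟩
    ∑[ u < n ] (k * collisions (seen u))    ≡⟨ *-distribˡ-sum k (λ u → collisions (seen u)) ⟨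
    k * ∑[ u < n ] collisions (seen u)      ∎
    where open ≤-Reasoning

  module _ (F-sym : ∀ v → Symmetric (F v)) (good : GoodForC4 F) where

    no-C4-of-cherries : ∀ {a b c d} → Distinct4 a b c d →
      ¬ (seen a b ≡ seen a d × seen b a ≡ seen b c × seen c b ≡ seen c d × seen d c ≡ seen d a)
    no-C4-of-cherries {a} {b} {c} {d} distinct (cherry-a , cherry-b , cherry-c , cherry-d)
      with good a b c d distinct
    ... | inj₁ (_ , _ , ab≢da , _) = ab≢da (trans cherry-a (F-sym a a d))
    ... | inj₂ (inj₁ (ab≢bc , _)) = ab≢bc (trans (F-sym b a b) cherry-b)
    ... | inj₂ (inj₂ (inj₁ (_ , _ , _ , bc≢cd , _))) = bc≢cd (trans (F-sym c b c) cherry-c)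
    ... | inj₂ (inj₂ (inj₂ (_ , _ , _ , _ , _ , cd≢da))) = cd≢da (trans (F-sym d c d) cherry-d)

    commonCentres : Fin n → Fin n → ℕ
    commonCentres a c = count (λ u → seen u a ≟ seen u c)

    CommonOuterCentre : Fin n → Fin n → Pred (Fin n) 0ℓ
    CommonOuterCentre a c u = (u ≢ a × u ≢ c) × seen u a ≡ seen u c

    commonOuterCentre? : ∀ a c → Decidable (CommonOuterCentre a c)
    commonOuterCentre? a c u = (¬? (u ≟ a) ×-dec ¬? (u ≟ c)) ×-dec (seen u a ≟ seen u c)

    count-commonOuterCentre≤k² : ∀ {a c} → a ≢ c → count (commonOuterCentre? a c) ≤ k * k
    count-commonOuterCentre≤k² {a} {c} a≢c = ≮⇒≥ λ k*k<count →
      let b , d , b≢d , ((b≢a , b≢c) , cherry-b) , ((d≢a , d≢c) , cherry-d) , same =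
            count-pigeonhole (commonOuterCentre? a c) (λ u → combine (seen a u) (seen c u)) k*k<count
          cherry-a , cherry-c = combine-injective (seen a b) (seen c b) (seen a d) (seen c d) same
      in no-C4-of-cherries (≢-sym b≢a , a≢c , ≢-sym d≢a , b≢c , b≢d , ≢-sym d≢c)
                           (cherry-a , cherry-b , cherry-c , sym cherry-d)

    commonCentres≤k²+2 : ∀ {a c} → a ≢ c → commonCentres a c ≤ k * k + 2
    commonCentres≤k²+2 {a} {c} a≢c = begin
      commonCentres a c
        ≤⟨ sum-mono-≤ split ⟩
      ∑[ u < n ] (𝟙 (commonOuterCentre? a c u) + (𝟙 (a ≟ u) + 𝟙 (c ≟ u)))
        ≡⟨ trans (∑-distrib-+ (𝟙 ∘ commonOuterCentre? a c) _) (cong (count (commonOuterCentre? a c) +_) (∑-distrib-+ (𝟙 ∘ (a ≟_)) (𝟙 ∘ (c ≟_)))) ⟩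
      count (commonOuterCentre? a c) + (count (a ≟_) + count (c ≟_))
        ≤⟨ +-mono-≤ (count-commonOuterCentre≤k² a≢c) (≤-reflexive (cong₂ _+_ (count-≟ a) (count-≟ c))) ⟩
      k * k + 2 ∎
      where
      open ≤-Reasoning
      outerOrEnd : ∀ u → seen u a ≡ seen u c → CommonOuterCentre a c u ⊎ (a ≡ u ⊎ c ≡ u)
      outerOrEnd u same with u ≟ a | u ≟ c
      ... | yes u≡a | _       = inj₂ (inj₁ (sym u≡a))
      ... | no _    | yes u≡c = inj₂ (inj₂ (sym u≡c))
      ... | no u≢a  | no u≢c  = inj₁ ((u≢a , u≢c) , same)
      split : ∀ u → 𝟙 (seen u a ≟ seen u c) ≤ 𝟙 (commonOuterCentre? a c u) + (𝟙 (a ≟ u) + 𝟙 (c ≟ u))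
      split u = ≤-trans (𝟙-⊎-≤ (seen u a ≟ seen u c) (commonOuterCentre? a c u) (a ≟ u ⊎-dec c ≟ u) (outerOrEnd u))
                        (+-monoʳ-≤ _ (𝟙-⊎-≤ (a ≟ u ⊎-dec c ≟ u) (a ≟ u) (c ≟ u) id))

    commonCentres≤ : ∀ a c → commonCentres a c ≤ k * k + 2 + 𝟙 (c ≟ a) * n
    commonCentres≤ a c with c ≟ a
    ... | yes refl = ≤-trans (count-≤ _) (≤-trans (m≤m+n n 0) (m≤n+m (n + 0) (k * k + 2)))
    ... | no c≢a   = ≤-trans (commonCentres≤k²+2 (≢-sym c≢a)) (≤-reflexive (sym (+-identityʳ _)))

    ∑collisions≡∑commonCentres : ∑[ u < n ] collisions (seen u) ≡ ∑[ a < n ] ∑[ c < n ] commonCentres c a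
    ∑collisions≡∑commonCentres =
      trans (∑-comm (λ u a → count (λ c → seen u c ≟ seen u a)))
            (sum-cong-≗ (λ a → ∑-comm (λ u c → 𝟙 (seen u c ≟ seen u a))))

    ∑collisions≤ : ∑[ u < n ] collisions (seen u) ≤ n * (n * (k * k + 2) + n)
    ∑collisions≤ = begin
      ∑[ u < n ] collisions (seen u)                          ≡⟨ ∑collisions≡∑commonCentres ⟩
      ∑[ a < n ] ∑[ c < n ] commonCentres c a                 ≤⟨ sum-mono-≤ (λ a → sum-mono-≤ (λ c → commonCentres≤ c a)) ⟩
      ∑[ a < n ] ∑[ c < n ] (k * k + 2 + 𝟙 (a ≟ c) * n)       ≡⟨ sum-cong-≗ diagonal ⟩
      ∑[ a < n ] (n * (k * k + 2) + n)                        ≡⟨ sum-const n _ ⟩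
      n * (n * (k * k + 2) + n)                               ∎
      where
      open ≤-Reasoning
      diagonal : ∀ a → ∑[ c < n ] (k * k + 2 + 𝟙 (a ≟ c) * n) ≡ n * (k * k + 2) + n
      diagonal a = trans (∑-distrib-+ (λ _ → k * k + 2) (λ c → 𝟙 (a ≟ c) * n))
                         (cong₂ _+_ (sum-const n (k * k + 2)) (∑-𝟙≟* a (λ _ → n)))

n≤k[k²+3] : ∀ {n k} → AdmitsC4 n k → n ≤ k * (k * k + 3)
n≤k[k²+3] {zero} _ = z≤n
n≤k[k²+3] {n@(suc _)} {k} (F , F-sym , good) = *-cancelˡ-≤ n (*-cancelˡ-≤ n (begin
  n * (n * n)                           ≤⟨ ∑collisions≥ F ⟩
  k * ∑[ u < n ] collisions (seen F u)  ≤⟨ *-monoʳ-≤ k (∑collisions≤ F F-sym good) ⟩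
  k * (n * (n * (k * k + 2) + n))       ≡⟨ rearrange n k ⟩
  n * (n * (k * (k * k + 3)))           ∎))
  where
  open ≤-Reasoning
  rearrange : ∀ n k → k * (n * (n * (k * k + 2) + n)) ≡ n * (n * (k * (k * k + 3)))
  rearrange = solve-∀

k[k²+3]≤4k³ : ∀ k → k * (k * k + 3) ≤ 4 * k ^ 3
k[k²+3]≤4k³ zero = z≤n
k[k²+3]≤4k³ k@(suc _) = begin
  k * (k * k + 3)    ≡⟨ expand k ⟩
  k ^ 3 + 3 * k      ≤⟨ +-monoʳ-≤ (k ^ 3) (*-monoʳ-≤ 3 k≤k³) ⟩
  k ^ 3 + 3 * k ^ 3  ≡⟨ collect (k ^ 3) ⟩
  4 * k ^ 3          ∎
  where
  open ≤-Reasoning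
  k≤k³ : k ≤ k ^ 3
  k≤k³ = subst (_≤ k ^ 3) (^-identityʳ k) (^-monoʳ-≤ k {1} {3} (s≤s z≤n))
  expand : ∀ k → k * (k * k + 3) ≡ k * (k * (k * 1)) + 3 * k
  expand = solve-∀
  collect : ∀ k³ → k³ + 3 * k³ ≡ 4 * k³
  collect = solve-∀

proposition1 : Σ ℕ λ D → Σ ℕ λ N → (n k : ℕ) → N ≤ n → AdmitsC4 n k →
    n ≤ D * k ^ 3
proposition1 = 4 , 0 , λ n k _ admits → ≤-trans (n≤k[k²+3] admits) (k[k²+3]≤4k³ k)
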